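{- Let $p$ be a program of the split fireball calculus. (1) If $p\to_{\beta_f} q$ (in the split fireball calculus) then $p{\downarrow}\to_{\beta_f} q{\downarrow}$ (in the fireball calculus). (2) If $p{\downarrow}\to_{\beta_f} u$ (in the fireball calculus) then there exists a program $q$ such that $p\to_{\beta_f} q$ (in the split fireball calculus) and $q{\downarrow}=u$.
   Context: Terms: $t,u ::= x \mid \lambda x.t \mid tu$, up to $\alpha$-equivalence; $t\{x\leftarrow u\}$ is capture-avoiding substitution. Values: $v ::= x \mid \lambda x.t$. Fireballs $f$ and inert terms $i$ are defined by mutual induction: $f ::= v \mid i$ and $i ::= x f_1 \dots f_n$ with $n>0$ (application left-associative). Right evaluation contexts: $C ::= \langle\cdot\rangle \mid t\,C \mid C\,f$. Fireball calculus (on terms): $C\langle(\lambda x.t)v\rangle\to_{\beta_f}C\langle t\{x\leftarrow v\}\rangle$ and $C\langle(\lambda x.t)i\rangle\to_{\beta_f}C\langle t\{x\leftarrow i\}\rangle$. Split fireball calculus: environments $E ::= \epsilon \mid [x\leftarrow i]:E$; programs $p=(t,E)$; reduction $(C\langle(\lambda x.t)v\rangle,E)\to_{\beta_f}(C\langle t\{x\leftarrow v\}\rangle,E)$ and $(C\langle(\lambda x.t)i\rangle,E)\to_{\beta_f}(C\langle t\rangle,[x\leftarrow i]:E)$. Unfolding of programs: $(t,\epsilon){\downarrow}=t$ and $(t,[x\leftarrow i]:E){\downarrow}=(t\{x\leftarrow i\},E){\downarrow}$. -}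

module Defs where

open import Data.Nat using (ℕ; zero; suc)
open import Data.Fin using (Fin; zero; suc)
open import Data.Product using (Σ; _×_; _,_)

infixl 7 _·_
data Term (n : ℕ) : Set where
  var : Fin n → Term n
  ƛ   : Term (suc n) → Term n
  _·_ : Term n → Term n → Term n

ext : ∀ {m k} → (Fin m → Fin k) → Fin (suc m) → Fin (suc k)
ext ρ zero    = zero
ext ρ (suc x) = suc (ρ x)

rename : ∀ {m k} → (Fin m → Fin k) → Term m → Term k
rename ρ (var x) = var (ρ x)
rename ρ (ƛ t)   = ƛ (rename (ext ρ) t)
rename ρ (t · u) = rename ρ t · rename ρ u

exts : ∀ {m k} → (Fin m → Term k) → Fin (suc m) → Term (suc k)
exts σ zero    = var zero
exts σ (suc x) = rename suc (σ x)

subst : ∀ {m k} → (Fin m → Term k) → Term m → Term k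
subst σ (var x) = σ x
subst σ (ƛ t)   = ƛ (subst (exts σ) t)
subst σ (t · u) = subst σ t · subst σ u

σ₀ : ∀ {n} → Term n → Fin (suc n) → Term n
σ₀ u zero    = u
σ₀ u (suc x) = var x

-- t { x ← u }, where x is the de Bruijn variable 0 bound in t
_[_] : ∀ {n} → Term (suc n) → Term n → Term n
t [ u ] = subst (σ₀ u) t

data Value {n : ℕ} : Term n → Set where
  v-var : (x : Fin n) → Value (var x)
  v-lam : (t : Term (suc n)) → Value (ƛ t)

mutual
  data Fireball {n : ℕ} : Term n → Set where
    f-val   : ∀ {t} → Value t → Fireball t
    f-inert : ∀ {t} → Inert t → Fireball t

  data Inert {n : ℕ} : Term n → Set where
    i-var : ∀ {f} (x : Fin n) → Fireball f → Inert (var x · f)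
    i-app : ∀ {i f} → Inert i → Fireball f → Inert (i · f)

-- Right evaluation contexts  C ::= ⟨·⟩ | t C | C f
data Ctx (n : ℕ) : Set where
  hole : Ctx n
  _·ᶜ_ : Term n → Ctx n → Ctx n
  _ᶜ·_ : Ctx n → Term n → Ctx n

data EvalCtx {n : ℕ} : Ctx n → Set where
  ec-hole : EvalCtx hole
  ec-left : ∀ {C} (t : Term n) → EvalCtx C → EvalCtx (t ·ᶜ C)
  ec-right : ∀ {C f} → EvalCtx C → Fireball f → EvalCtx (C ᶜ· f)

_⟨_⟩ : ∀ {n} → Ctx n → Term n → Term n
hole ⟨ t ⟩     = t
(u ·ᶜ C) ⟨ t ⟩ = u · (C ⟨ t ⟩)
(C ᶜ· f) ⟨ t ⟩ = (C ⟨ t ⟩) · f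

renameCtx : ∀ {m k} → (Fin m → Fin k) → Ctx m → Ctx k
renameCtx ρ hole     = hole
renameCtx ρ (u ·ᶜ C) = rename ρ u ·ᶜ renameCtx ρ C
renameCtx ρ (C ᶜ· f) = renameCtx ρ C ᶜ· rename ρ f

infix 4 _⟶f_
data _⟶f_ {n : ℕ} : Term n → Term n → Set where
  βv : ∀ (C : Ctx n) → EvalCtx C → (t : Term (suc n)) (v : Term n) → Value v →
       C ⟨ ƛ t · v ⟩ ⟶f C ⟨ t [ v ] ⟩
  βi : ∀ (C : Ctx n) → EvalCtx C → (t : Term (suc n)) (i : Term n) → Inert i →
       C ⟨ ƛ t · i ⟩ ⟶f C ⟨ t [ i ] ⟩

-- Env n m: the term of the program lives in scope m, the
-- entries bind (m - n) variables, and n is the scope of free variables.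
-- In [x ← i] : E, x is de Bruijn variable 0 of the term, and i lives in
-- the scope of E.
data Env (n : ℕ) : ℕ → Set where
  ε   : Env n n
  _∷_ : ∀ {m} → Σ (Term m) Inert → Env n m → Env n (suc m)

Program : ℕ → Set
Program n = Σ ℕ (λ m → Term m × Env n m)

unfoldEnv : ∀ {n m} → Env n m → Term m → Term n
unfoldEnv ε       t = t
unfoldEnv ((i , _) ∷ E) t = unfoldEnv E (t [ i ])

_↓ : ∀ {n} → Program n → Term n
(m , t , E) ↓ = unfoldEnv E t

infix 4 _⟶s_
data _⟶s_ {n : ℕ} : Program n → Program n → Set where
  βv : ∀ {m} (C : Ctx m) → EvalCtx C → (t : Term (suc m)) (v : Term m) → Value v →
       (E : Env n m) →
       (m , C ⟨ ƛ t · v ⟩ , E) ⟶s (m , C ⟨ t [ v ] ⟩ , E)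
  -- x is chosen fresh: the context is weakened past the new binder
  βi : ∀ {m} (C : Ctx m) → EvalCtx C → (t : Term (suc m)) (i : Term m) (ii : Inert i) →
       (E : Env n m) →
       (m , C ⟨ ƛ t · i ⟩ , E) ⟶s (suc m , renameCtx suc C ⟨ t ⟩ , (i , ii) ∷ E)

module Submission where

-- Unfolding an environment is an iterated substitution σ₀ i of inert terms i for
-- variables. Such substitutions send variables to variables or inert terms, so they
-- both preserve and reflect being a fireball. Preservation makes them map fireball
-- steps to fireball steps, which gives (1). Reflection gives (2): substituting
-- inert terms never creates a redex in evaluation position, so every step of
-- t { x ← i } is the image of a step of t, and a step of the term of a program is
-- simulated by a split step.

open import Defs
open import Data.Nat using (ℕ; suc)
open import Data.Fin using (Fin; zero; suc)
open import Data.Product using (Σ; _×_; _,_; proj₁)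
open import Relation.Nullary using (¬_)
open import Data.Empty using (⊥-elim)
open import Relation.Binary.PropositionalEquality
  using (_≡_; refl; sym; trans; cong; cong₂; _≗_; module ≡-Reasoning)
  renaming (subst to transport)

ext-cong : ∀ {m k} {ρ ρ′ : Fin m → Fin k} → ρ ≗ ρ′ → ext ρ ≗ ext ρ′
ext-cong h zero    = refl
ext-cong h (suc x) = cong suc (h x)

rename-cong : ∀ {m k} {ρ ρ′ : Fin m → Fin k} → ρ ≗ ρ′ → ∀ t → rename ρ t ≡ rename ρ′ t
rename-cong h (var x) = cong var (h x)
rename-cong h (ƛ t)   = cong ƛ (rename-cong (ext-cong h) t)
rename-cong h (t · u) = cong₂ _·_ (rename-cong h t) (rename-cong h u)

exts-cong : ∀ {m k} {σ σ′ : Fin m → Term k} → σ ≗ σ′ → exts σ ≗ exts σ′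
exts-cong h zero    = refl
exts-cong h (suc x) = cong (rename suc) (h x)

subst-cong : ∀ {m k} {σ σ′ : Fin m → Term k} → σ ≗ σ′ → ∀ t → subst σ t ≡ subst σ′ t
subst-cong h (var x) = h x
subst-cong h (ƛ t)   = cong ƛ (subst-cong (exts-cong h) t)
subst-cong h (t · u) = cong₂ _·_ (subst-cong h t) (subst-cong h u)

rename-rename : ∀ {a b c} (ρ : Fin b → Fin c) (ρ′ : Fin a → Fin b) t →
  rename ρ (rename ρ′ t) ≡ rename (λ x → ρ (ρ′ x)) t
rename-rename ρ ρ′ (var x) = refl
rename-rename ρ ρ′ (ƛ t)   = cong ƛ (trans (rename-rename (ext ρ) (ext ρ′) t)
  (rename-cong (λ { zero → refl ; (suc x) → refl }) t))
rename-rename ρ ρ′ (t · u) = cong₂ _·_ (rename-rename ρ ρ′ t) (rename-rename ρ ρ′ u)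

subst-rename : ∀ {a b c} (σ : Fin b → Term c) (ρ : Fin a → Fin b) t →
  subst σ (rename ρ t) ≡ subst (λ x → σ (ρ x)) t
subst-rename σ ρ (var x) = refl
subst-rename σ ρ (ƛ t)   = cong ƛ (trans (subst-rename (exts σ) (ext ρ) t)
  (subst-cong (λ { zero → refl ; (suc x) → refl }) t))
subst-rename σ ρ (t · u) = cong₂ _·_ (subst-rename σ ρ t) (subst-rename σ ρ u)

rename-subst : ∀ {a b c} (ρ : Fin b → Fin c) (σ : Fin a → Term b) t →
  rename ρ (subst σ t) ≡ subst (λ x → rename ρ (σ x)) t
rename-subst ρ σ (var x) = refl
rename-subst ρ σ (ƛ t)   = cong ƛ (trans (rename-subst (ext ρ) (exts σ) t) (subst-cong exts-rename t))
  where
  exts-rename : ∀ x → rename (ext ρ) (exts σ x) ≡ exts (λ y → rename ρ (σ y)) x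
  exts-rename zero    = refl
  exts-rename (suc x) = trans (rename-rename (ext ρ) suc (σ x)) (sym (rename-rename suc ρ (σ x)))
rename-subst ρ σ (t · u) = cong₂ _·_ (rename-subst ρ σ t) (rename-subst ρ σ u)

subst-subst : ∀ {a b c} (σ : Fin b → Term c) (τ : Fin a → Term b) t →
  subst σ (subst τ t) ≡ subst (λ x → subst σ (τ x)) t
subst-subst σ τ (var x) = refl
subst-subst σ τ (ƛ t)   = cong ƛ (trans (subst-subst (exts σ) (exts τ) t) (subst-cong exts-subst t))
  where
  exts-subst : ∀ x → subst (exts σ) (exts τ x) ≡ exts (λ y → subst σ (τ y)) x
  exts-subst zero    = refl
  exts-subst (suc x) = trans (subst-rename (exts σ) suc (τ x)) (sym (rename-subst suc σ (τ x)))
subst-subst σ τ (t · u) = cong₂ _·_ (subst-subst σ τ t) (subst-subst σ τ u)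

subst-var : ∀ {m} (t : Term m) → subst var t ≡ t
subst-var (var x) = refl
subst-var (ƛ t)   = cong ƛ (trans (subst-cong (λ { zero → refl ; (suc x) → refl }) t) (subst-var t))
subst-var (t · u) = cong₂ _·_ (subst-var t) (subst-var u)

rename-suc-[] : ∀ {m} (u i : Term m) → rename suc u [ i ] ≡ u
rename-suc-[] u i = trans (subst-rename (σ₀ i) suc u) (subst-var u)

subst-[] : ∀ {m k} (σ : Fin m → Term k) t v →
  subst σ (t [ v ]) ≡ subst (exts σ) t [ subst σ v ]
subst-[] σ t v = begin
  subst σ (t [ v ])
    ≡⟨ subst-subst σ (σ₀ v) t ⟩
  subst (λ x → subst σ (σ₀ v x)) t
    ≡⟨ subst-cong σ₀-exts t ⟩
  subst (λ x → subst (σ₀ (subst σ v)) (exts σ x)) t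
    ≡⟨ sym (subst-subst (σ₀ (subst σ v)) (exts σ) t) ⟩
  subst (exts σ) t [ subst σ v ]
    ∎
  where
  open ≡-Reasoning
  σ₀-exts : ∀ x → subst σ (σ₀ v x) ≡ subst (σ₀ (subst σ v)) (exts σ x)
  σ₀-exts zero    = refl
  σ₀-exts (suc x) = sym (rename-suc-[] (σ x) (subst σ v))

plug-rename-suc-[] : ∀ {m} (C : Ctx m) t (i : Term m) →
  renameCtx suc C ⟨ t ⟩ [ i ] ≡ C ⟨ t [ i ] ⟩
plug-rename-suc-[] hole     t i = refl
plug-rename-suc-[] (u ·ᶜ C) t i = cong₂ _·_ (rename-suc-[] u i) (plug-rename-suc-[] C t i)
plug-rename-suc-[] (C ᶜ· f) t i = cong₂ _·_ (plug-rename-suc-[] C t i) (rename-suc-[] f i)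

data VarOrInert {n : ℕ} : Term n → Set where
  is-var   : (x : Fin n) → VarOrInert (var x)
  is-inert : ∀ {t} → Inert t → VarOrInert t

InertSubst : ∀ {m k} → (Fin m → Term k) → Set
InertSubst {m} σ = (x : Fin m) → VarOrInert (σ x)

σ₀-inertSubst : ∀ {m} {i : Term m} → Inert i → InertSubst (σ₀ i)
σ₀-inertSubst ii zero    = is-inert ii
σ₀-inertSubst ii (suc x) = is-var x

varOrInert⇒fireball : ∀ {n} {t : Term n} → VarOrInert t → Fireball t
varOrInert⇒fireball (is-var x)   = f-val (v-var x)
varOrInert⇒fireball (is-inert i) = f-inert i

app-inert : ∀ {n} {t f : Term n} → VarOrInert t → Fireball f → Inert (t · f)
app-inert (is-var x)   = i-var x
app-inert (is-inert i) = i-app i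

app-inert-head : ∀ {n} {t f : Term n} → Inert (t · f) → VarOrInert t
app-inert-head (i-var x _) = is-var x
app-inert-head (i-app i _) = is-inert i

app-inert-arg : ∀ {n} {t f : Term n} → Inert (t · f) → Fireball f
app-inert-arg (i-var _ f) = f
app-inert-arg (i-app _ f) = f

-- Casing on the context first makes the plugged term a constructor application,
-- so that unification discards the impossible cases.
mutual
  inert-no-redex : ∀ {n} {C : Ctx n} {s a} → EvalCtx C → ¬ Inert (C ⟨ ƛ s · a ⟩)
  inert-no-redex ec-hole         (i-app () _)
  inert-no-redex (ec-left _ ec)  i = fireball-no-redex ec (app-inert-arg i)
  inert-no-redex (ec-right ec _) i = varOrInert-no-redex ec (app-inert-head i)

  varOrInert-no-redex : ∀ {n} {C : Ctx n} {s a} → EvalCtx C → ¬ VarOrInert (C ⟨ ƛ s · a ⟩)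
  varOrInert-no-redex ec-hole          (is-inert i) = inert-no-redex ec-hole i
  varOrInert-no-redex ec@(ec-left _ _)  (is-inert i) = inert-no-redex ec i
  varOrInert-no-redex ec@(ec-right _ _) (is-inert i) = inert-no-redex ec i

  fireball-no-redex : ∀ {n} {C : Ctx n} {s a} → EvalCtx C → ¬ Fireball (C ⟨ ƛ s · a ⟩)
  fireball-no-redex ec-hole          (f-inert i) = inert-no-redex ec-hole i
  fireball-no-redex ec@(ec-left _ _)  (f-inert i) = inert-no-redex ec i
  fireball-no-redex ec@(ec-right _ _) (f-inert i) = inert-no-redex ec i

·-injective : ∀ {n} {t u t′ u′ : Term n} → t · u ≡ t′ · u′ → (t ≡ t′) × (u ≡ u′)
·-injective refl = refl , refl

contract : ∀ {n} (s : Term (suc n)) {a : Term n} → Fireball a → ƛ s · a ⟶f s [ a ]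
contract s (f-val v)   = βv hole ec-hole s _ v
contract s (f-inert i) = βi hole ec-hole s _ i

ξ-arg : ∀ {n} (t : Term n) {u u′} → u ⟶f u′ → t · u ⟶f t · u′
ξ-arg t (βv C ec s v val) = βv (t ·ᶜ C) (ec-left t ec) s v val
ξ-arg t (βi C ec s i ii)  = βi (t ·ᶜ C) (ec-left t ec) s i ii

ξ-fun : ∀ {n} {f t t′ : Term n} → Fireball f → t ⟶f t′ → t · f ⟶f t′ · f
ξ-fun ff (βv C ec s v val) = βv (C ᶜ· _) (ec-right ec ff) s v val
ξ-fun ff (βi C ec s i ii)  = βi (C ᶜ· _) (ec-right ec ff) s i ii

module _ {m k} {σ : Fin m → Term k} (σ-inert : InertSubst σ) where

  mutual
    subst-fireball : ∀ {f} → Fireball f → Fireball (subst σ f)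
    subst-fireball (f-val (v-var x)) = varOrInert⇒fireball (σ-inert x)
    subst-fireball (f-val (v-lam t)) = f-val (v-lam _)
    subst-fireball (f-inert i)       = f-inert (subst-inert i)

    subst-inert : ∀ {i} → Inert i → Inert (subst σ i)
    subst-inert (i-var x f) = app-inert (σ-inert x) (subst-fireball f)
    subst-inert (i-app i f) = i-app (subst-inert i) (subst-fireball f)

  mutual
    subst-varOrInert⁻¹ : ∀ t → VarOrInert (subst σ t) → VarOrInert t
    subst-varOrInert⁻¹ (var x)  _            = is-var x
    subst-varOrInert⁻¹ (ƛ t)    (is-inert ())
    subst-varOrInert⁻¹ (t · u) (is-inert i)  = is-inert (subst-app-inert⁻¹ t u i)

    subst-fireball⁻¹ : ∀ t → Fireball (subst σ t) → Fireball t
    subst-fireball⁻¹ (var x)  _           = f-val (v-var x)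
    subst-fireball⁻¹ (ƛ t)    _           = f-val (v-lam t)
    subst-fireball⁻¹ (t · u) (f-inert i) = f-inert (subst-app-inert⁻¹ t u i)

    subst-app-inert⁻¹ : ∀ t u → Inert (subst σ t · subst σ u) → Inert (t · u)
    subst-app-inert⁻¹ t u i =
      app-inert (subst-varOrInert⁻¹ t (app-inert-head i)) (subst-fireball⁻¹ u (app-inert-arg i))

  subst-contract : ∀ s {a} → Fireball a → subst σ (ƛ s · a) ⟶f subst σ (s [ a ])
  subst-contract s {a} fa =
    transport (_⟶f_ _) (sym (subst-[] σ s a)) (contract _ (subst-fireball fa))

  subst-plug-step : ∀ {C} {t t′} → EvalCtx C → subst σ t ⟶f subst σ t′ →
    subst σ (C ⟨ t ⟩) ⟶f subst σ (C ⟨ t′ ⟩)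
  subst-plug-step ec-hole          st = st
  subst-plug-step (ec-left u ec)   st = ξ-arg (subst σ u) (subst-plug-step ec st)
  subst-plug-step (ec-right ec ff) st = ξ-fun (subst-fireball ff) (subst-plug-step ec st)

  subst-step : ∀ {t t′} → t ⟶f t′ → subst σ t ⟶f subst σ t′
  subst-step (βv C ec s v val) = subst-plug-step ec (subst-contract s (f-val val))
  subst-step (βi C ec s i ii)  = subst-plug-step ec (subst-contract s (f-inert ii))

  -- σ x is a variable or inert, hence contains no redex in evaluation position:
  -- the redex of σ t is the image of a redex of t.
  subst-plug-step⁻¹ : ∀ t {C s a} → EvalCtx C → Fireball a → subst σ t ≡ C ⟨ ƛ s · a ⟩ →
    Σ (Term m) λ t′ → (t ⟶f t′) × (subst σ t′ ≡ C ⟨ s [ a ] ⟩)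
  subst-plug-step⁻¹ (var x) ec fa eq =
    ⊥-elim (varOrInert-no-redex ec (transport VarOrInert eq (σ-inert x)))
  subst-plug-step⁻¹ (ƛ t) ec-hole        fa ()
  subst-plug-step⁻¹ (ƛ t) (ec-left _ _)  fa ()
  subst-plug-step⁻¹ (ƛ t) (ec-right _ _) fa ()
  subst-plug-step⁻¹ (var x · u) ec-hole fa eq
    with transport VarOrInert (proj₁ (·-injective eq)) (σ-inert x)
  ... | is-inert ()
  subst-plug-step⁻¹ (ƛ s · u) ec-hole fa refl =
    s [ u ] , contract s (subst-fireball⁻¹ u fa) , subst-[] σ s u
  subst-plug-step⁻¹ ((_ · _) · u) ec-hole fa ()
  subst-plug-step⁻¹ (t · u) (ec-left _ ec) fa eq with ·-injective eq
  ... | refl , eq-arg with subst-plug-step⁻¹ u ec fa eq-arg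
  ... | u′ , st , eq′ = t · u′ , ξ-arg t st , cong (subst σ t ·_) eq′
  subst-plug-step⁻¹ (t · u) (ec-right ec ff) fa eq with ·-injective eq
  ... | eq-fun , refl with subst-plug-step⁻¹ t ec fa eq-fun
  ... | t′ , st , eq′ =
    t′ · u , ξ-fun (subst-fireball⁻¹ u ff) st , cong (_· subst σ u) eq′

  subst-step⁻¹ : ∀ t {u} → subst σ t ⟶f u → Σ (Term m) λ t′ → (t ⟶f t′) × (subst σ t′ ≡ u)
  subst-step⁻¹ t st = from-redex st refl
    where
    from-redex : ∀ {x u} → x ⟶f u → subst σ t ≡ x →
      Σ (Term m) λ t′ → (t ⟶f t′) × (subst σ t′ ≡ u)
    from-redex (βv C ec s v val) = subst-plug-step⁻¹ t ec (f-val val)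
    from-redex (βi C ec s i ii)  = subst-plug-step⁻¹ t ec (f-inert ii)

unfold-step : ∀ {n m} (E : Env n m) {t t′} → t ⟶f t′ → unfoldEnv E t ⟶f unfoldEnv E t′
unfold-step ε                st = st
unfold-step ((i , ii) ∷ E) st = unfold-step E (subst-step (σ₀-inertSubst ii) st)

unfold-step⁻¹ : ∀ {n m} (E : Env n m) t {u} → unfoldEnv E t ⟶f u →
  Σ (Term m) λ t′ → (t ⟶f t′) × (unfoldEnv E t′ ≡ u)
unfold-step⁻¹ ε                t st = _ , st , refl
unfold-step⁻¹ ((i , ii) ∷ E) t st with unfold-step⁻¹ E (t [ i ]) st
... | _ , stᵢ , eq with subst-step⁻¹ (σ₀-inertSubst ii) t stᵢ
... | t′ , st′ , eqᵢ = t′ , st′ , trans (cong (unfoldEnv E) eqᵢ) eq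

split-step⇒step : ∀ {n} {p q : Program n} → p ⟶s q → p ↓ ⟶f q ↓
split-step⇒step (βv C ec t v val E) = unfold-step E (βv C ec t v val)
split-step⇒step (βi C ec t i ii E)  =
  transport (_⟶f_ _) (cong (unfoldEnv E) (sym (plug-rename-suc-[] C t i)))
    (unfold-step E (βi C ec t i ii))

step⇒split-step : ∀ {n m} (E : Env n m) {t t′} → t ⟶f t′ →
  Σ (Program n) λ q → ((m , t , E) ⟶s q) × (q ↓ ≡ unfoldEnv E t′)
step⇒split-step E (βv C ec s v val) = _ , βv C ec s v val E , refl
step⇒split-step E (βi C ec s i ii)  =
  _ , βi C ec s i ii E , cong (unfoldEnv E) (plug-rename-suc-[] C s i)

proposition4 : ∀ {n : ℕ} (p : Program n) →
    ((q : Program n) → p ⟶s q → (p ↓) ⟶f (q ↓))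
    × ((u : Term n) → (p ↓) ⟶f u → Σ (Program n) (λ q → (p ⟶s q) × (q ↓ ≡ u)))
proposition4 (m , t , E) = (λ q → split-step⇒step) , simulate
  where
  simulate : ∀ u → unfoldEnv E t ⟶f u → Σ (Program _) λ q → ((m , t , E) ⟶s q) × (q ↓ ≡ u)
  simulate u st with unfold-step⁻¹ E t st
  ... | t′ , st′ , eq with step⇒split-step E st′
  ... | q , sst , eq′ = q , sst , trans eq′ eq
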